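{- Let $G$ be an $n$-vertex near triangulation that is isomorphic to $K_4$ or to $G_6^3$, with outer cycle $C$, and let $v$ be a vertex of $C$ with $d(v)=3$ that has a neighbor in $V(G)\setminus V(C)$. Then there exists a strongly connected orientation $D$ of $G$ such that $\mathrm{diam}(D)=\overrightarrow{\mathrm{diam}}(G)=\frac{n}{2}+1$ and $\max\{d_D(u,v),d_D(v,u)\}\le \frac{n}{2}$ for all $u\in V(G)$.
   Context: A near triangulation is a simple plane graph in which every face except possibly the outer face is bounded by a triangle; here its outer face is bounded by a cycle $C$. $K_4$ is embedded with an outer triangle and one interior vertex. $G_6^3$ is the near triangulation with vertices $u_1,u_2,u_3,x,a,b$, edges $u_1u_2,u_1u_3,u_2u_3,xu_1,xu_2,xu_3,u_2a,ab,bu_3,u_2b$, outer cycle $u_1u_2abu_3u_1$ and $x$ inside the triangle $u_1u_2u_3$. For a directed graph $D$, $d_D(u,v)$ is the length of a shortest directed $u$–$v$ path, $\mathrm{diam}(D)=\max_{u,v}d_D(u,v)$, and $\overrightarrow{\mathrm{diam}}(G)$ is the minimum of $\mathrm{diam}(D)$ over strongly connected orientations $D$ of $G$. -}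

module Defs where

open import Data.Nat using (ℕ; zero; suc; _≤_; _<_; _+_)
open import Data.Fin using (Fin; zero; suc)
open import Data.Bool using (Bool; true; false; not; _∨_)
open import Data.List using (List; length; filterᵇ; allFin)
open import Data.Product using (Σ; ∃; _×_; _,_)
open import Data.Sum using (_⊎_)
open import Relation.Nullary using (¬_)
open import Relation.Binary.PropositionalEquality using (_≡_)
open import Function.Bundles using (_↔_; Inverse)

record Graph (n : ℕ) : Set where
  field
    adj   : Fin n → Fin n → Bool
    sym   : ∀ u v → adj u v ≡ adj v u
    irrefl : ∀ u → adj u u ≡ false
open Graph public

degree : ∀ {n} → Graph n → Fin n → ℕ
degree {n} G v = length (filterᵇ (adj G v) (allFin n))

record Orientation {n : ℕ} (G : Graph n) : Set where
  field
    arc      : Fin n → Fin n → Bool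
    arc⇒adj  : ∀ u v → arc u v ≡ true → adj G u v ≡ true
    oneWay   : ∀ u v → adj G u v ≡ true → arc u v ≡ not (arc v u)
open Orientation public

data Walk {n : ℕ} {G : Graph n} (D : Orientation G) : Fin n → Fin n → ℕ → Set where
  here : ∀ u → Walk D u u 0
  step : ∀ {u w v k} → arc D u w ≡ true → Walk D w v k → Walk D u v (suc k)

DistLe : ∀ {n} {G : Graph n} → Orientation G → Fin n → Fin n → ℕ → Set
DistLe D u v k = Σ ℕ λ m → m ≤ k × Walk D u v m

StronglyConnected : ∀ {n} {G : Graph n} → Orientation G → Set
StronglyConnected {n} D = ∀ (u v : Fin n) → Σ ℕ λ k → Walk D u v k

DiamLe : ∀ {n} {G : Graph n} → Orientation G → ℕ → Set
DiamLe {n} D k = ∀ (u v : Fin n) → DistLe D u v k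

DiamEq : ∀ {n} {G : Graph n} → Orientation G → ℕ → Set
DiamEq D k = DiamLe D k × (∀ j → j < k → ¬ DiamLe D j)

OrientDiamEq : ∀ {n} → Graph n → ℕ → Set
OrientDiamEq G k =
  (Σ (Orientation G) λ D → StronglyConnected D × DiamEq D k)
  × (∀ (D : Orientation G) → StronglyConnected D → ∀ j → j < k → ¬ DiamLe D j)

K4adj : Fin 4 → Fin 4 → Bool
K4adj zero zero = false
K4adj (suc zero) (suc zero) = false
K4adj (suc (suc zero)) (suc (suc zero)) = false
K4adj (suc (suc (suc zero))) (suc (suc (suc zero))) = false
K4adj _ _ = true

K4 : Graph 4
K4 = record { adj = K4adj ; sym = s ; irrefl = i }
  where
  s : ∀ u v → K4adj u v ≡ K4adj v u
  s zero zero = Relation.Binary.PropositionalEquality.refl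
  s zero (suc zero) = Relation.Binary.PropositionalEquality.refl
  s zero (suc (suc zero)) = Relation.Binary.PropositionalEquality.refl
  s zero (suc (suc (suc zero))) = Relation.Binary.PropositionalEquality.refl
  s (suc zero) zero = Relation.Binary.PropositionalEquality.refl
  s (suc zero) (suc zero) = Relation.Binary.PropositionalEquality.refl
  s (suc zero) (suc (suc zero)) = Relation.Binary.PropositionalEquality.refl
  s (suc zero) (suc (suc (suc zero))) = Relation.Binary.PropositionalEquality.refl
  s (suc (suc zero)) zero = Relation.Binary.PropositionalEquality.refl
  s (suc (suc zero)) (suc zero) = Relation.Binary.PropositionalEquality.refl
  s (suc (suc zero)) (suc (suc zero)) = Relation.Binary.PropositionalEquality.refl
  s (suc (suc zero)) (suc (suc (suc zero))) = Relation.Binary.PropositionalEquality.refl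
  s (suc (suc (suc zero))) zero = Relation.Binary.PropositionalEquality.refl
  s (suc (suc (suc zero))) (suc zero) = Relation.Binary.PropositionalEquality.refl
  s (suc (suc (suc zero))) (suc (suc zero)) = Relation.Binary.PropositionalEquality.refl
  s (suc (suc (suc zero))) (suc (suc (suc zero))) = Relation.Binary.PropositionalEquality.refl
  i : ∀ u → K4adj u u ≡ false
  i zero = Relation.Binary.PropositionalEquality.refl
  i (suc zero) = Relation.Binary.PropositionalEquality.refl
  i (suc (suc zero)) = Relation.Binary.PropositionalEquality.refl
  i (suc (suc (suc zero))) = Relation.Binary.PropositionalEquality.refl

K4outer : Fin 4 → Bool
K4outer (suc (suc (suc zero))) = false
K4outer _ = true

-- G_6^3: u1 = 0, u2 = 1, u3 = 2, x = 3, a = 4, b = 5.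
-- Edges u1u2,u1u3,u2u3,xu1,xu2,xu3,u2a,ab,bu3,u2b;
-- outer cycle u1 u2 a b u3 u1, x inside the triangle u1u2u3.
G63edge : Fin 6 → Fin 6 → Bool
G63edge zero (suc zero) = true
G63edge zero (suc (suc zero)) = true
G63edge (suc zero) (suc (suc zero)) = true
G63edge (suc (suc (suc zero))) zero = true
G63edge (suc (suc (suc zero))) (suc zero) = true
G63edge (suc (suc (suc zero))) (suc (suc zero)) = true
G63edge (suc zero) (suc (suc (suc (suc zero)))) = true
G63edge (suc (suc (suc (suc zero)))) (suc (suc (suc (suc (suc zero))))) = true
G63edge (suc (suc (suc (suc (suc zero))))) (suc (suc zero)) = true
G63edge (suc zero) (suc (suc (suc (suc (suc zero))))) = true
G63edge _ _ = false

G63adj : Fin 6 → Fin 6 → Bool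
G63adj u v = G63edge u v ∨ G63edge v u

G63 : Graph 6
G63 = record { adj = G63adj ; sym = s ; irrefl = i }
  where
  open import Data.Bool.Properties using (∨-comm)
  s : ∀ u v → G63adj u v ≡ G63adj v u
  s u v = ∨-comm (G63edge u v) (G63edge v u)
  i : ∀ u → G63adj u u ≡ false
  i zero = Relation.Binary.PropositionalEquality.refl
  i (suc zero) = Relation.Binary.PropositionalEquality.refl
  i (suc (suc zero)) = Relation.Binary.PropositionalEquality.refl
  i (suc (suc (suc zero))) = Relation.Binary.PropositionalEquality.refl
  i (suc (suc (suc (suc zero)))) = Relation.Binary.PropositionalEquality.refl
  i (suc (suc (suc (suc (suc zero))))) = Relation.Binary.PropositionalEquality.refl

G63outer : Fin 6 → Bool
G63outer (suc (suc (suc zero))) = false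
G63outer _ = true

PlaneIso : ∀ {n m} → Graph n → (Fin n → Bool) → Graph m → (Fin m → Bool) → Set
PlaneIso {n} {m} G onC M outerM =
  Σ (Fin n ↔ Fin m) λ f →
    (∀ u v → adj G u v ≡ adj M (Inverse.to f u) (Inverse.to f v))
    × (∀ u → onC u ≡ outerM (Inverse.to f u))

{-# OPTIONS --safe #-}

-- Both model graphs are small enough for exhaustive search. Bounded reachability is a
-- Boolean computation, and every orientation of a graph is contained in one of the
-- 2^|E| ways of directing a fixed list of its edges; so "no orientation of K4 (resp.
-- G63) has diameter at most 2 (resp. 3)" is checked by evaluation, and for every vertex
-- an explicit orientation of diameter 3 (resp. 4) puts that vertex within 2 (resp. 3) of
-- and from every other vertex. All of this transfers along the plane isomorphism.

module Submission where

open import Defs hiding (sym)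
open import Data.Nat using (ℕ; zero; suc; _+_; _≤_; _<_; z≤n; s≤s; ⌊_/2⌋)
open import Data.Nat.Properties using (≤-trans; ≤-refl)
open import Data.Fin using (Fin)
open import Data.Fin.Patterns using (0F; 1F; 2F; 3F; 4F; 5F)
open import Data.Fin.Properties using (_≟_; _<?_; <-cmp; all?)
open import Data.Fin.Permutation using (↔⇒≡)
open import Data.Bool using (Bool; true; false; T; not; _∧_; _∨_; if_then_else_)
import Data.Bool.Properties as Bool
open import Data.Bool.Properties using (T-∧; T-∨; T-≡)
open import Data.Bool.ListAction using (any)
open import Data.List using (List; []; _∷_; _++_; map; allFin; filter; cartesianProduct)
open import Data.List.Membership.Propositional using (_∈_; lose)
open import Data.List.Membership.Propositional.Properties
  using (∈-allFin; ∈-map⁺; ∈-++⁺ˡ; ∈-++⁺ʳ; ∈-filter⁺; ∈-cartesianProduct⁺)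
open import Data.List.Relation.Unary.Any using (here; there; satisfied)
open import Data.List.Relation.Unary.Any.Properties using (any⁺; any⁻)
open import Data.List.Relation.Unary.All as All using (All)
open import Data.Product using (Σ; _×_; _,_; proj₁; proj₂)
open import Data.Product.Properties using (≡-dec)
open import Data.Sum using (_⊎_; inj₁; inj₂)
open import Function.Bundles using (_↔_; Inverse; Equivalence)
open import Function.Properties.Inverse using (↔-sym)
open import Relation.Binary using (tri<; tri≈; tri>)
open import Relation.Binary.PropositionalEquality
  using (_≡_; refl; sym; trans; cong; cong₂; subst₂)
open import Relation.Nullary using (¬_; Dec; contradiction)
open import Relation.Nullary.Decidable
  using (True; isYes; toWitness; fromWitness; T?; ¬?; _×-dec_; _→-dec_)

private
  variable
    m n k l : ℕ

Digraph : ℕ → Set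
Digraph m = Fin m → Fin m → Bool

reachᵇ : Digraph m → ℕ → Fin m → Fin m → Bool
reachᵇ a zero    u v = isYes (u ≟ v)
reachᵇ a (suc k) u v = isYes (u ≟ v) ∨ any (λ w → a u w ∧ reachᵇ a k w v) (allFin _)

Diam≤ : Digraph m → ℕ → Set
Diam≤ a k = ∀ u v → T (reachᵇ a k u v)

diam≤? : (a : Digraph m) (k : ℕ) → Dec (Diam≤ a k)
diam≤? a k = all? λ u → all? λ v → T? (reachᵇ a k u v)

reachᵇ-refl : (a : Digraph m) (k : ℕ) (u : Fin m) → T (reachᵇ a k u u)
reachᵇ-refl a zero    u = fromWitness {a? = u ≟ u} refl
reachᵇ-refl a (suc k) u =
  Equivalence.from (T-∨ {isYes (u ≟ u)}) (inj₁ (fromWitness {a? = u ≟ u} refl))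

reachᵇ-step : (a : Digraph m) (k : ℕ) → ∀ {u w v} →
              T (a u w) → T (reachᵇ a k w v) → T (reachᵇ a (suc k) u v)
reachᵇ-step a k {u} {w} {v} uw wv =
  Equivalence.from (T-∨ {isYes (u ≟ v)}) (inj₂ (any⁺ _ (lose (∈-allFin w)
    (Equivalence.from (T-∧ {a u w}) (uw , wv)))))

reachᵇ-suc⁻ : (a : Digraph m) (k : ℕ) → ∀ {u v} → T (reachᵇ a (suc k) u v) →
              u ≡ v ⊎ Σ (Fin m) λ w → T (a u w) × T (reachᵇ a k w v)
reachᵇ-suc⁻ {m} a k {u} {v} r with Equivalence.to (T-∨ {isYes (u ≟ v)}) r
... | inj₁ u≡v = inj₁ (toWitness {a? = u ≟ v} u≡v)
... | inj₂ r′ with satisfied (any⁻ _ (allFin m) r′)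
... | w , uwv = inj₂ (w , Equivalence.to (T-∧ {a u w}) uwv)

module _ {G : Graph m} (D : Orientation G) where

  walk⇒reachᵇ : (a : Digraph m) → (∀ x y → arc D x y ≡ true → T (a x y)) →
                ∀ {u v} → Walk D u v l → l ≤ k → T (reachᵇ a k u v)
  walk⇒reachᵇ {k = k} a arc⊆a (here u) _ = reachᵇ-refl a k u
  walk⇒reachᵇ {k = suc k} a arc⊆a (step {u} {w} uw wv) (s≤s l≤k) =
    reachᵇ-step a k (arc⊆a u w uw) (walk⇒reachᵇ a arc⊆a wv l≤k)

  reachᵇ⇒DistLe : ∀ k u v → T (reachᵇ (arc D) k u v) → DistLe D u v k
  reachᵇ⇒DistLe zero u v r with refl ← toWitness {a? = u ≟ v} r = 0 , z≤n , here u
  reachᵇ⇒DistLe (suc k) u v r with reachᵇ-suc⁻ (arc D) k r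
  ... | inj₁ refl = 0 , z≤n , here u
  ... | inj₂ (w , uw , wv) with reachᵇ⇒DistLe k w v wv
  ... | l , l≤k , walk = suc l , s≤s l≤k , step (Equivalence.to T-≡ uw) walk

  DiamLe⇒Diam≤ : (a : Digraph m) → (∀ x y → arc D x y ≡ true → T (a x y)) →
                 DiamLe D k → Diam≤ a k
  DiamLe⇒Diam≤ a arc⊆a diam u v with diam u v
  ... | l , l≤k , walk = walk⇒reachᵇ a arc⊆a walk l≤k

  Diam≤⇒DiamLe : Diam≤ (arc D) k → DiamLe D k
  Diam≤⇒DiamLe {k} diam u v = reachᵇ⇒DistLe k u v (diam u v)

  DiamLe-mono : ∀ {j} → j ≤ k → DiamLe D j → DiamLe D k
  DiamLe-mono j≤k diam u v with diam u v
  ... | l , l≤j , walk = l , ≤-trans l≤j j≤k , walk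

  DiamLe⇒StronglyConnected : DiamLe D k → StronglyConnected D
  DiamLe⇒StronglyConnected diam u v with diam u v
  ... | l , _ , walk = l , walk

  arc-antisym : ∀ {x y} → arc D x y ≡ true → arc D y x ≡ false
  arc-antisym {x} {y} xy =
    trans (oneWay D y x (trans (Graph.sym G y x) (arc⇒adj D x y xy))) (cong not xy)

IsOrientation : Graph m → Digraph m → Set
IsOrientation M a =
  ∀ u v → (a u v ≡ true → adj M u v ≡ true) × (adj M u v ≡ true → a u v ≡ not (a v u))

isOrientation? : (M : Graph m) (a : Digraph m) → Dec (IsOrientation M a)
isOrientation? M a = all? λ u → all? λ v →
  ((a u v Bool.≟ true) →-dec (adj M u v Bool.≟ true))
  ×-dec ((adj M u v Bool.≟ true) →-dec (a u v Bool.≟ not (a v u)))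

toOrientation : (M : Graph m) (a : Digraph m) → IsOrientation M a → Orientation M
toOrientation M a isOrientation = record
  { arc = a
  ; arc⇒adj = λ u v → proj₁ (isOrientation u v)
  ; oneWay = λ u v → proj₂ (isOrientation u v)
  }

⟦_⟧ : List (Fin m × Fin m) → Digraph m
⟦ arcs ⟧ x y = any (λ e → isYes (≡-dec _≟_ _≟_ (x , y) e)) arcs

∈⇒⟦⟧ : ∀ {arcs : List (Fin m × Fin m)} {x y} → (x , y) ∈ arcs → T (⟦ arcs ⟧ x y)
∈⇒⟦⟧ {x = x} {y} xy∈arcs =
  any⁺ _ (lose xy∈arcs (fromWitness {a? = ≡-dec _≟_ _≟_ (x , y) (x , y)} refl))

edges : Graph m → List (Fin m × Fin m)
edges {m} M = filter (λ e → proj₁ e <? proj₂ e ×-dec adj M (proj₁ e) (proj₂ e) Bool.≟ true)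
                     (cartesianProduct (allFin m) (allFin m))

edges-cover : (M : Graph m) → ∀ {x y} → adj M x y ≡ true →
              (x , y) ∈ edges M ⊎ (y , x) ∈ edges M
edges-cover M {x} {y} xy with <-cmp x y
... | tri< x<y _ _ = inj₁ (∈-filter⁺ _ (∈-cartesianProduct⁺ (∈-allFin x) (∈-allFin y)) (x<y , xy))
... | tri≈ _ refl _ = contradiction (trans (sym xy) (irrefl M x)) λ ()
... | tri> _ _ y<x = inj₂ (∈-filter⁺ _ (∈-cartesianProduct⁺ (∈-allFin y) (∈-allFin x))
                                      (y<x , trans (Graph.sym M y x) xy))

orientations : {A : Set} → List (A × A) → List (List (A × A))
orientations []              = [] ∷ []
orientations ((s , t) ∷ es) =
  map ((s , t) ∷_) (orientations es) ++ map ((t , s) ∷_) (orientations es)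

directedBy : {G : Graph m} → Orientation G → List (Fin m × Fin m) → List (Fin m × Fin m)
directedBy D []              = []
directedBy D ((s , t) ∷ es) = (if arc D s t then (s , t) else (t , s)) ∷ directedBy D es

directedBy∈orientations : {G : Graph m} (D : Orientation G) (es : List (Fin m × Fin m)) →
                          directedBy D es ∈ orientations es
directedBy∈orientations D []              = here refl
directedBy∈orientations D ((s , t) ∷ es) with arc D s t
... | true  = ∈-++⁺ˡ (∈-map⁺ _ (directedBy∈orientations D es))
... | false = ∈-++⁺ʳ _ (∈-map⁺ _ (directedBy∈orientations D es))

arc∈directedBy : {G : Graph m} (D : Orientation G) (es : List (Fin m × Fin m)) → ∀ {x y} →
                 (x , y) ∈ es ⊎ (y , x) ∈ es → arc D x y ≡ true → (x , y) ∈ directedBy D es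
arc∈directedBy D (_ ∷ es) (inj₁ (here refl)) xy rewrite xy = here refl
arc∈directedBy D (_ ∷ es) (inj₂ (here refl)) xy rewrite arc-antisym D xy = here refl
arc∈directedBy D (_ ∷ es) (inj₁ (there xy∈es)) xy = there (arc∈directedBy D es (inj₁ xy∈es) xy)
arc∈directedBy D (_ ∷ es) (inj₂ (there yx∈es)) xy = there (arc∈directedBy D es (inj₂ yx∈es) xy)

NoOrientationWithin : Graph m → ℕ → Set
NoOrientationWithin M k = All (λ arcs → ¬ Diam≤ ⟦ arcs ⟧ k) (orientations (edges M))

noOrientationWithin? : (M : Graph m) (k : ℕ) → Dec (NoOrientationWithin M k)
noOrientationWithin? M k = All.all? (λ arcs → ¬? (diam≤? ⟦ arcs ⟧ k)) (orientations (edges M))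

NoOrientationWithin⇒¬DiamLe : (M : Graph m) → NoOrientationWithin M k →
                              (D : Orientation M) → ¬ DiamLe D k
NoOrientationWithin⇒¬DiamLe M none D diam =
  All.lookup none (directedBy∈orientations D (edges M)) (DiamLe⇒Diam≤ D _ arc⊆ diam)
  where
  arc⊆ : ∀ x y → arc D x y ≡ true → T (⟦ directedBy D (edges M) ⟧ x y)
  arc⊆ x y xy = ∈⇒⟦⟧ (arc∈directedBy D (edges M) (edges-cover M (arc⇒adj D x y xy)) xy)

OptimalCentredOrientation : Graph n → ℕ → Fin n → Set
OptimalCentredOrientation {n} G k v =
  Σ (Orientation G) λ D →
    StronglyConnected D
    × DiamEq D (suc k)
    × OrientDiamEq G (suc k)
    × (∀ (u : Fin n) → DistLe D u v k × DistLe D v u k)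

mkOptimalCentredOrientation : (M : Graph m) → (∀ (D : Orientation M) → ¬ DiamLe D k) →
  ∀ {x} (D : Orientation M) → DiamLe D (suc k) → (∀ u → DistLe D u x k × DistLe D x u k) →
  OptimalCentredOrientation M k x
mkOptimalCentredOrientation {k = k} M none D diam centred =
  D , connected , optimal , ((D , connected , optimal) , lower) , centred
  where
  lower : ∀ (D′ : Orientation M) → StronglyConnected D′ → ∀ j → j < suc k → ¬ DiamLe D′ j
  lower D′ _ j (s≤s j≤k) diam′ = none D′ (DiamLe-mono D′ j≤k diam′)
  connected : StronglyConnected D
  connected = DiamLe⇒StronglyConnected D diam
  optimal : DiamEq D (suc k)
  optimal = diam , lower D connected

module _ {G : Graph n} {H : Graph m} (f : Fin n ↔ Fin m)
         (f-adj : ∀ u v → adj G u v ≡ adj H (Inverse.to f u) (Inverse.to f v)) where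

  open Inverse f using (to; from; strictlyInverseˡ; strictlyInverseʳ)

  pullback : Orientation H → Orientation G
  pullback D = record
    { arc     = λ u v → arc D (to u) (to v)
    ; arc⇒adj = λ u v uv → trans (f-adj u v) (arc⇒adj D _ _ uv)
    ; oneWay  = λ u v uv → oneWay D _ _ (trans (sym (f-adj u v)) uv)
    }

  walk-pullback : (D : Orientation H) → ∀ {x y} →
                  Walk D x y l → Walk (pullback D) (from x) (from y) l
  walk-pullback D (here x) = here (from x)
  walk-pullback D (step {x} {w} xw wy) =
    step (subst₂ (λ s t → arc D s t ≡ true) (sym (strictlyInverseˡ x)) (sym (strictlyInverseˡ w))
                 xw)
         (walk-pullback D wy)

  DistLe-pullback : (D : Orientation H) → ∀ {u v} →
                    DistLe D (to u) (to v) k → DistLe (pullback D) u v k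
  DistLe-pullback D {u} {v} (l , l≤k , walk) =
    l , l≤k , subst₂ (λ s t → Walk (pullback D) s t l) (strictlyInverseʳ u) (strictlyInverseʳ v)
                     (walk-pullback D walk)

  DiamLe-pullback : (D : Orientation H) → DiamLe D k → DiamLe (pullback D) k
  DiamLe-pullback D diam u v = DistLe-pullback D (diam (to u) (to v))

  from-adj : ∀ x y → adj H x y ≡ adj G (from x) (from y)
  from-adj x y = sym (trans (f-adj (from x) (from y))
                            (cong₂ (adj H) (strictlyInverseˡ x) (strictlyInverseˡ y)))

OptimalCentredOrientation-transport : ∀ {n m k}
  {G : Graph n} {H : Graph m} (f : Fin n ↔ Fin m) →
  (∀ u v → adj G u v ≡ adj H (Inverse.to f u) (Inverse.to f v)) →
  ∀ {v} → OptimalCentredOrientation H k (Inverse.to f v) → OptimalCentredOrientation G k v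
OptimalCentredOrientation-transport {n} {m} {k} {G} {H} f f-adj
  (D , _ , (diam , _) , (_ , lowerH) , centred) =
  mkOptimalCentredOrientation G lowerG (pullback f f-adj D) (DiamLe-pullback f f-adj D diam)
    λ u → DistLe-pullback f f-adj D (proj₁ (centred (Inverse.to f u)))
        , DistLe-pullback f f-adj D (proj₂ (centred (Inverse.to f u)))
  where
  f⁻¹ : Fin m ↔ Fin n
  f⁻¹ = ↔-sym f
  f⁻¹-adj : ∀ x y → adj H x y ≡ adj G (Inverse.to f⁻¹ x) (Inverse.to f⁻¹ y)
  f⁻¹-adj = from-adj {G = G} {H = H} f f-adj
  push : Orientation G → Orientation H
  push = pullback f⁻¹ f⁻¹-adj
  lowerG : ∀ (D′ : Orientation G) → ¬ DiamLe D′ k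
  lowerG D′ diam′ = lowerH (push D′)
    (DiamLe⇒StronglyConnected _ diam″) k ≤-refl diam″
    where
    diam″ : DiamLe (push D′) k
    diam″ = DiamLe-pullback f⁻¹ f⁻¹-adj D′ diam′

CentredWithin : Digraph m → ℕ → Fin m → Set
CentredWithin a k x = ∀ u → T (reachᵇ a k u x) × T (reachᵇ a k x u)

centredWithin? : (a : Digraph m) (k : ℕ) (x : Fin m) → Dec (CentredWithin a k x)
centredWithin? a k x = all? λ u → T? (reachᵇ a k u x) ×-dec T? (reachᵇ a k x u)

CentredOrientation : Graph m → ℕ → List (Fin m × Fin m) → Fin m → Set
CentredOrientation M k arcs x =
  IsOrientation M ⟦ arcs ⟧ × Diam≤ ⟦ arcs ⟧ (suc k) × CentredWithin ⟦ arcs ⟧ k x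

centredOrientation? : (M : Graph m) (k : ℕ) (arcs : List (Fin m × Fin m)) (x : Fin m) →
                      Dec (CentredOrientation M k arcs x)
centredOrientation? M k arcs x =
  isOrientation? M ⟦ arcs ⟧ ×-dec diam≤? ⟦ arcs ⟧ (suc k) ×-dec centredWithin? ⟦ arcs ⟧ k x

optimalCentredOrientation-fromChecks :
  (M : Graph m) (k : ℕ) (centredAt : Fin m → List (Fin m × Fin m)) →
  True (noOrientationWithin? M k) →
  True (all? λ x → centredOrientation? M k (centredAt x) x) →
  ∀ x → OptimalCentredOrientation M k x
optimalCentredOrientation-fromChecks M k centredAt none centred x
  with isOrientation , diam , centredAtX ← toWitness centred x =
  mkOptimalCentredOrientation M (NoOrientationWithin⇒¬DiamLe M (toWitness none)) D
    (Diam≤⇒DiamLe D diam)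
    λ u → reachᵇ⇒DistLe D k u x (proj₁ (centredAtX u))
        , reachᵇ⇒DistLe D k x u (proj₂ (centredAtX u))
  where
  D : Orientation M
  D = toOrientation M ⟦ centredAt x ⟧ isOrientation

K4-centredAt : Fin 4 → List (Fin 4 × Fin 4)
K4-centredAt 1F = (1F , 0F) ∷ (0F , 2F) ∷ (3F , 0F) ∷ (2F , 1F) ∷ (1F , 3F) ∷ (3F , 2F) ∷ []
K4-centredAt 2F = (1F , 0F) ∷ (0F , 2F) ∷ (3F , 0F) ∷ (2F , 1F) ∷ (1F , 3F) ∷ (3F , 2F) ∷ []
K4-centredAt _  = (1F , 0F) ∷ (2F , 0F) ∷ (0F , 3F) ∷ (2F , 1F) ∷ (3F , 1F) ∷ (3F , 2F) ∷ []

K4-optimal : ∀ x → OptimalCentredOrientation K4 2 x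
K4-optimal = optimalCentredOrientation-fromChecks K4 2 K4-centredAt _ _

G63-centredAt : Fin 6 → List (Fin 6 × Fin 6)
G63-centredAt c = (1F , 0F) ∷ (2F , 0F) ∷ (2F , 1F) ∷ (0F , 3F) ∷ (3F , 1F) ∷ xu₃
                ∷ (1F , 4F) ∷ (4F , 5F) ∷ (5F , 2F) ∷ (1F , 5F) ∷ []
  where
  xu₃ : Fin 6 × Fin 6
  xu₃ = if isYes (c ≟ 3F) ∨ isYes (c ≟ 4F) then (2F , 3F) else (3F , 2F)

G63-optimal : ∀ x → OptimalCentredOrientation G63 3 x
G63-optimal = optimalCentredOrientation-fromChecks G63 3 G63-centredAt _ _

-- The orientation exists for every vertex v.
lemma2p6 : ∀ {n : ℕ} (G : Graph n) (onC : Fin n → Bool)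
    → (PlaneIso G onC K4 K4outer ⊎ PlaneIso G onC G63 G63outer)
    → (v : Fin n) → onC v ≡ true → degree G v ≡ 3
    → Σ (Fin n) (λ w → adj G v w ≡ true × onC w ≡ false)
    → Σ (Orientation G) λ D →
        StronglyConnected D
        × DiamEq D (⌊ n /2⌋ + 1)
        × OrientDiamEq G (⌊ n /2⌋ + 1)
        × (∀ (u : Fin n) → DistLe D u v ⌊ n /2⌋ × DistLe D v u ⌊ n /2⌋)
lemma2p6 G onC (inj₁ (f , f-adj , _)) v _ _ _ with refl ← ↔⇒≡ f =
  OptimalCentredOrientation-transport f f-adj (K4-optimal (Inverse.to f v))
lemma2p6 G onC (inj₂ (f , f-adj , _)) v _ _ _ with refl ← ↔⇒≡ f =
  OptimalCentredOrientation-transport f f-adj (G63-optimal (Inverse.to f v))
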